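{- Let $G=([n]\cup[n]',E)$ be a convex bipartite graph that contains a perfect matching. Let $r=\max_{i\in[n]}\deg(i)$ and $c=\max_{j\in[n]}\deg(j')$. Then $c\le 2r-1$.
   Context: A bipartite graph $G=([m]\cup[n]',E)$ has parts $[m]=\{1,\dots,m\}$ and $[n]'=\{1',\dots,n'\}$. It is convex if, after some permutation of $[m]$ and of $[n]'$, the neighbourhood of every $i\in[m]$ is an interval of consecutive elements of $[n]'$. -}

module Defs where

open import Data.Nat using (ℕ; _≤_; _⊔_)
open import Data.Bool using (Bool; true; T)
open import Data.Fin using (Fin; toℕ)
open import Data.Fin.Permutation using (Permutation′; _⟨$⟩ʳ_)
open import Data.List using (List; length; filter; foldr; map; allFin)
open import Data.Product using (Σ; ∃; ∃-syntax; _×_)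
open import Function.Bundles using (_⇔_)
open import Relation.Binary.PropositionalEquality using (_≡_)

-- A bipartite graph G = ([m] ∪ [n]', E), given by its biadjacency relation:
-- E i j = true  iff  {i, j'} is an edge.
BipGraph : ℕ → ℕ → Set
BipGraph m n = Fin m → Fin n → Bool

degL : ∀ {m n} → BipGraph m n → Fin m → ℕ
degL {n = n} E i = length (filter (λ j → Data.Bool._≟_ (E i j) true) (allFin n))
  where import Data.Bool

degR : ∀ {m n} → BipGraph m n → Fin n → ℕ
degR {m = m} E j = length (filter (λ i → Data.Bool._≟_ (E i j) true) (allFin m))
  where import Data.Bool

maxList : List ℕ → ℕ
maxList = foldr _⊔_ 0

maxDegL : ∀ {m n} → BipGraph m n → ℕ
maxDegL {m = m} E = maxList (map (degL E) (allFin m))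

maxDegR : ∀ {m n} → BipGraph m n → ℕ
maxDegR {n = n} E = maxList (map (degR E) (allFin n))

-- Convex: after some permutation σ of [m] and τ of [n]', the neighbourhood of
-- every vertex of [m] is an interval of consecutive elements of [n]'
-- (the neighbourhood {j | E (σ i) (τ j)} equals {j | a ≤ j ≤ b} for some a, b;
-- a > b gives the empty interval).
Convex : ∀ {m n} → BipGraph m n → Set
Convex {m} {n} E =
  Σ (Permutation′ m) λ σ → Σ (Permutation′ n) λ τ → ((i : Fin m) → ∃[ a ] ∃[ b ] ((j : Fin n) →
    (T (E (σ ⟨$⟩ʳ i) (τ ⟨$⟩ʳ j)) ⇔ (a ≤ toℕ j × toℕ j ≤ b))))

HasPerfectMatching : ∀ {n} → BipGraph n n → Set
HasPerfectMatching {n} E = Σ (Permutation′ n) λ π → (i : Fin n) → T (E i (π ⟨$⟩ʳ i))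

-- Relabel the columns so that every row neighbourhood is an interval. Two columns
-- in the interval of row i are then less than deg(i) ≤ r apart. For a column j and
-- each neighbour i of j, the matched column π(i) lies in the interval of row i
-- together with j, hence strictly within distance r of j. These matched columns are
-- distinct, and only 2r − 1 positions lie strictly within distance r of j.
module Submission where

open import Defs
open import Data.Nat using (ℕ; suc; _+_; _*_; _∸_; _≤_; _<_; z≤n; s≤s; _≤?_)
open import Data.Nat.Properties
open import Data.Bool using (true; T)
import Data.Bool as Bool
open import Data.Bool.Properties using (T-≡)
open import Data.Fin using (Fin; toℕ; fromℕ<)
open import Data.Fin.Properties using (toℕ-injective; toℕ<n; toℕ≤pred[n]; toℕ-fromℕ<)
open import Data.Fin.Permutation using (Permutation′; _⟨$⟩ʳ_; _⟨$⟩ˡ_; inverseʳ; flip)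
open import Data.List using (List; []; _∷_; length; filter; map; allFin; tabulate; applyUpTo)
open import Data.List.Properties using (length-map; length-tabulate; length-applyUpTo; length-removeAt′)
open import Data.List.Relation.Unary.Any using (here; there; index; _─_)
open import Data.List.Relation.Unary.All as All using ()
open import Data.List.Relation.Unary.AllPairs using (_∷_)
open import Data.List.Membership.Propositional using (_∈_)
open import Data.List.Membership.Propositional.Properties
  using (∈-map⁻; ∈-filter⁺; ∈-filter⁻; ∈-allFin; ∈-tabulate⁻; ∈-applyUpTo⁺)
open import Data.List.Relation.Binary.Subset.Propositional using (_⊆_)
open import Data.List.Relation.Unary.Unique.Propositional using (Unique)
open import Data.List.Relation.Unary.Unique.Propositional.Properties
  using (map⁺; filter⁺; allFin⁺; tabulate⁺)
open import Data.Product using (Σ; ∃-syntax; _×_; _,_; proj₁; proj₂)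
open import Data.Empty using (⊥-elim)
open import Function.Base using (_∘_)
open import Function.Bundles using (_⇔_; Equivalence; Injection)
open import Function.Properties.Inverse using (↔⇒↣)
open import Relation.Nullary using (yes; no; contradiction)
open import Relation.Binary.PropositionalEquality
  using (_≡_; _≢_; refl; sym; cong; cong₂; subst; module ≡-Reasoning)

module _ {A : Set} where

  ∈-─ : ∀ {x z : A} {ys} (x∈ys : x ∈ ys) → z ∈ ys → z ≢ x → z ∈ (ys ─ x∈ys)
  ∈-─ (here refl)  (here refl)  z≢x = ⊥-elim (z≢x refl)
  ∈-─ (here _)     (there z∈ys) _   = z∈ys
  ∈-─ (there _)    (here z≡y)   _   = here z≡y
  ∈-─ (there x∈ys) (there z∈ys) z≢x = there (∈-─ x∈ys z∈ys z≢x)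

  Unique∧⊆⇒length≤ : ∀ {xs ys : List A} → Unique xs → xs ⊆ ys → length xs ≤ length ys
  Unique∧⊆⇒length≤ {[]}          _               _     = z≤n
  Unique∧⊆⇒length≤ {x ∷ xs} {ys} (x≢xs ∷ unique) xs⊆ys = begin
    suc (length xs)          ≤⟨ s≤s (Unique∧⊆⇒length≤ unique xs⊆ys─x) ⟩
    suc (length (ys ─ x∈ys)) ≡⟨ sym (length-removeAt′ ys (index x∈ys)) ⟩
    length ys                ∎
    where
    open ≤-Reasoning
    x∈ys : x ∈ ys
    x∈ys = xs⊆ys (here refl)
    xs⊆ys─x : xs ⊆ (ys ─ x∈ys)
    xs⊆ys─x z∈xs = ∈-─ x∈ys (xs⊆ys (there z∈xs)) (All.lookup x≢xs z∈xs ∘ sym)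

Unique⇒length≤width : ∀ {lo hi} {ys : List ℕ} → Unique ys →
  (∀ {y} → y ∈ ys → lo ≤ y × y < hi) → length ys ≤ hi ∸ lo
Unique⇒length≤width {lo} {hi} {ys} unique bounded =
  subst (length ys ≤_) (length-applyUpTo (lo +_) (hi ∸ lo)) (Unique∧⊆⇒length≤ unique ys⊆window)
  where
  ys⊆window : ys ⊆ applyUpTo (lo +_) (hi ∸ lo)
  ys⊆window y∈ys with lo≤y , y<hi ← bounded y∈ys =
    subst (_∈ _) (m+[n∸m]≡n lo≤y) (∈-applyUpTo⁺ (lo +_) (∸-monoˡ-< y<hi lo≤y))

module _ {A : Set} {f : A → ℕ} where

  ≤-maxList-map : ∀ {x xs} → x ∈ xs → f x ≤ maxList (map f xs)
  ≤-maxList-map {xs = y ∷ ys} (here refl) = m≤m⊔n (f y) _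
  ≤-maxList-map {xs = y ∷ ys} (there x∈ys) = ≤-trans (≤-maxList-map x∈ys) (m≤n⊔m (f y) _)

  maxList-map-lub : ∀ {b} → (∀ x → f x ≤ b) → ∀ xs → maxList (map f xs) ≤ b
  maxList-map-lub f≤b []       = z≤n
  maxList-map-lub f≤b (x ∷ xs) = ⊔-lub (f≤b x) (maxList-map-lub f≤b xs)

module _ {m n : ℕ} (E : BipGraph m n) where

  rowNeighbours : Fin m → List (Fin n)
  rowNeighbours i = filter (λ j → E i j Bool.≟ true) (allFin n)

  colNeighbours : Fin n → List (Fin m)
  colNeighbours j = filter (λ i → E i j Bool.≟ true) (allFin m)

  ∈-rowNeighbours⁺ : ∀ {i j} → T (E i j) → j ∈ rowNeighbours i
  ∈-rowNeighbours⁺ {i} eij =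
    ∈-filter⁺ (λ j → E i j Bool.≟ true) (∈-allFin _) (Equivalence.to T-≡ eij)

  ∈-colNeighbours⁻ : ∀ {i j} → i ∈ colNeighbours j → T (E i j)
  ∈-colNeighbours⁻ {j = j} i∈ =
    Equivalence.from T-≡ (proj₂ (∈-filter⁻ (λ i → E i j Bool.≟ true) {xs = allFin m} i∈))

  IntervalNeighbourhood : Permutation′ n → Fin m → Set
  IntervalNeighbourhood τ i =
    ∃[ a ] ∃[ b ] ((j : Fin n) → T (E i (τ ⟨$⟩ʳ j)) ⇔ (a ≤ toℕ j × toℕ j ≤ b))

  run<degL : ∀ (τ : Permutation′ n) i {v k} → v + k < n →
    (∀ j → v ≤ toℕ j → toℕ j ≤ v + k → T (E i (τ ⟨$⟩ʳ j))) → k < degL E i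
  run<degL τ i {v} {k} v+k<n run =
    subst (_≤ degL E i) (length-tabulate column)
      (Unique∧⊆⇒length≤ (tabulate⁺ column-injective) columns⊆rowNeighbours)
    where
    offset≤k : (t : Fin (suc k)) → v + toℕ t ≤ v + k
    offset≤k t = +-monoʳ-≤ v (toℕ≤pred[n] t)
    slot : Fin (suc k) → Fin n
    slot t = fromℕ< (≤-<-trans (offset≤k t) v+k<n)
    column : Fin (suc k) → Fin n
    column t = τ ⟨$⟩ʳ slot t
    column-injective : ∀ {s t} → column s ≡ column t → s ≡ t
    column-injective {s} {t} eq = toℕ-injective (+-cancelˡ-≡ v _ _ (begin
      v + toℕ s     ≡⟨ toℕ-fromℕ< _ ⟨
      toℕ (slot s)  ≡⟨ cong toℕ (Injection.injective (↔⇒↣ τ) eq) ⟩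
      toℕ (slot t)  ≡⟨ toℕ-fromℕ< _ ⟩
      v + toℕ t     ∎))
      where open ≡-Reasoning
    columns⊆rowNeighbours : tabulate column ⊆ rowNeighbours i
    columns⊆rowNeighbours c∈ with t , refl ← ∈-tabulate⁻ {f = column} c∈ =
      ∈-rowNeighbours⁺ (run (slot t)
        (subst (v ≤_) (sym (toℕ-fromℕ< _)) (m≤m+n v (toℕ t)))
        (subst (_≤ v + k) (sym (toℕ-fromℕ< _)) (offset≤k t)))

  interval-width : ∀ {τ i} → IntervalNeighbourhood τ i → ∀ {u v} →
    T (E i (τ ⟨$⟩ʳ u)) → T (E i (τ ⟨$⟩ʳ v)) → toℕ u < toℕ v + degL E i
  interval-width {τ} {i} (a , b , interval) {u} {v} eu ev with toℕ v + degL E i ≤? toℕ u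
  ... | no  v+d≰u = ≰⇒> v+d≰u
  ... | yes v+d≤u = contradiction (run<degL τ i (≤-<-trans v+d≤u (toℕ<n u)) run) (<-irrefl refl)
    where
    run : ∀ j → toℕ v ≤ toℕ j → toℕ j ≤ toℕ v + degL E i → T (E i (τ ⟨$⟩ʳ j))
    run j v≤j j≤v+d = Equivalence.from (interval j)
      ( ≤-trans (proj₁ (Equivalence.to (interval v) ev)) v≤j
      , ≤-trans (≤-trans j≤v+d v+d≤u) (proj₂ (Equivalence.to (interval u) eu)))

  convex⇒intervalNeighbourhoods :
    Convex E → Σ (Permutation′ n) λ τ → ∀ i → IntervalNeighbourhood τ i
  convex⇒intervalNeighbourhoods (σ , τ , intervals) =
    τ , λ i → subst (IntervalNeighbourhood τ) (inverseʳ σ) (intervals (σ ⟨$⟩ˡ i))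

window-size : ∀ q r → q + r + r ∸ suc q ≡ 2 * r ∸ 1
window-size q r = begin
  q + r + r ∸ suc q      ≡⟨ cong₂ _∸_ (+-assoc q r r) (+-comm 1 q) ⟩
  q + (r + r) ∸ (q + 1)  ≡⟨ [m+n]∸[m+o]≡n∸o q (r + r) 1 ⟩
  r + r ∸ 1              ≡⟨ cong (λ t → r + t ∸ 1) (+-identityʳ r) ⟨
  2 * r ∸ 1              ∎
  where open ≡-Reasoning

degR≤2r∸1 : ∀ {n} (E : BipGraph n n) (τ : Permutation′ n) →
  (∀ i → IntervalNeighbourhood E τ i) →
  (π : Permutation′ n) → (∀ i → T (E i (π ⟨$⟩ʳ i))) →
  ∀ {r} → (∀ i → degL E i ≤ r) → ∀ j → degR E j ≤ 2 * r ∸ 1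
degR≤2r∸1 {n} E τ intervals π matched {r} degL≤r j = begin
  degR E j                         ≡⟨ length-map shifted (colNeighbours E j) ⟨
  length (map shifted (colNeighbours E j))
    ≤⟨ Unique⇒length≤width (map⁺ shifted-injective (filter⁺ _ (allFin⁺ n))) bounded ⟩
  q + r + r ∸ suc q                ≡⟨ window-size q r ⟩
  2 * r ∸ 1                        ∎
  where
  open ≤-Reasoning
  q : ℕ
  q = toℕ (τ ⟨$⟩ˡ j)
  -- Positions are shifted by r so that the window (q − r, q + r) needs no truncated subtraction.
  shifted : Fin n → ℕ
  shifted i = toℕ (τ ⟨$⟩ˡ (π ⟨$⟩ʳ i)) + r
  shifted-injective : ∀ {i i′} → shifted i ≡ shifted i′ → i ≡ i′
  shifted-injective eq = Injection.injective (↔⇒↣ π)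
    (Injection.injective (↔⇒↣ (flip τ)) (toℕ-injective (+-cancelʳ-≡ r _ _ eq)))
  bounded : ∀ {y} → y ∈ map shifted (colNeighbours E j) → q < y × y < q + r + r
  bounded y∈ with i , i∈ , refl ← ∈-map⁻ shifted y∈ =
    <-≤-trans (width at-j at-πi) (+-monoʳ-≤ _ (degL≤r i)) ,
    +-monoˡ-< r (<-≤-trans (width at-πi at-j) (+-monoʳ-≤ q (degL≤r i)))
    where
    width : ∀ {u v} → T (E i (τ ⟨$⟩ʳ u)) → T (E i (τ ⟨$⟩ʳ v)) → toℕ u < toℕ v + degL E i
    width = interval-width E {τ} {i} (intervals i)
    at-j : T (E i (τ ⟨$⟩ʳ (τ ⟨$⟩ˡ j)))
    at-j = subst (T ∘ E i) (sym (inverseʳ τ)) (∈-colNeighbours⁻ E i∈)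
    at-πi : T (E i (τ ⟨$⟩ʳ (τ ⟨$⟩ˡ (π ⟨$⟩ʳ i))))
    at-πi = subst (T ∘ E i) (sym (inverseʳ τ)) (matched i)

lemma4 : (n : ℕ) (E : BipGraph n n) → Convex E → HasPerfectMatching E →
    maxDegR E ≤ 2 * maxDegL E ∸ 1
lemma4 n E convex (π , matched) =
  let τ , intervals = convex⇒intervalNeighbourhoods E convex in
  maxList-map-lub
    (degR≤2r∸1 E τ intervals π matched (λ i → ≤-maxList-map (∈-allFin i)))
    (allFin n)
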